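{- If $m=3b$ and $n=3c+1$ for some positive integers $b$ and $c$, then $va^\equiv_1(K_{m,n})=p(b+c:m,n)$.
   Context: All graphs are finite and simple. For a graph $G$ with $N=|V(G)|$ vertices, an equitable $q$-coloring of $G$ is a partition of $V(G)$ into $q$ (possibly empty) independent sets, each of size $\lfloor N/q\rfloor$ or $\lceil N/q\rceil$. An equitable $(q,r)$-tree-coloring of $G$ is a partition of $V(G)$ into $q$ sets, each of size $\lfloor N/q\rfloor$ or $\lceil N/q\rceil$, such that each set induces a forest of maximum degree at most $r$. The strong equitable vertex $r$-arboricity $va^\equiv_r(G)$ is the minimum $p$ such that $G$ has an equitable $(q,r)$-tree-coloring for every integer $q\ge p$. $K_{n_1,\ldots,n_k}$ is the complete $k$-partite graph with partite sets of sizes $n_1,\ldots,n_k$; $K_{m,n}$ is the complete bipartite graph with parts of sizes $m$ and $n$. Definition of $p$: suppose $K_{n_1,\ldots,n_k}$ has an equitable $q$-coloring. Then $p(q:n_1,\ldots,n_k)=\lceil n_1/d\rceil+\cdots+\lceil n_k/d\rceil$, where $d$ is the minimum integer with $d\ge\lceil (n_1+\cdots+n_k)/q\rceil$ satisfying at least one of: (i) there exist $i\ne j$ such that neither $n_i$ nor $n_j$ is divisible by $d$; (ii) there exists $i$ with $n_i/\lfloor n_i/d\rfloor>d+1$. -}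

module Defs where

open import Data.Nat using (ℕ; zero; suc; _+_; _*_; _≤_; _<_; _<ᵇ_; _/_)
open import Data.Nat.Divisibility using (_∣_)
open import Data.Bool using (Bool)
open import Data.Fin using (Fin; toℕ; inject₁; fromℕ; _≟_) renaming (zero to fzero; suc to fsuc)
open import Data.List using (List; length; filter)
open import Data.List.Relation.Unary.All using (All)
open import Data.List.Relation.Unary.Unique.Propositional using (Unique)
open import Data.Product using (Σ; _×_)
open import Data.Sum using (_⊎_)
open import Data.Empty using (⊥)
open import Relation.Nullary using (¬_)
open import Relation.Binary.PropositionalEquality using (_≡_; _≢_)
open import Function.Definitions using (Injective)
open import Data.List using (allFin)
import Relation.Binary.PropositionalEquality

record Graph : Set₁ where
  field
    N      : ℕ
    Adj    : Fin N → Fin N → Set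
    sym    : ∀ {u v} → Adj u v → Adj v u
    irrefl : ∀ {v} → ¬ Adj v v
open Graph public

-- floor and ceiling of a / q (q = 0 never matters below; set to 0)
⌊_/_⌋ : ℕ → ℕ → ℕ
⌊ a / zero ⌋  = 0
⌊ a / suc q ⌋ = a / suc q

⌈_/_⌉ : ℕ → ℕ → ℕ
⌈ a / zero ⌉  = 0
⌈ a / suc q ⌉ = (a + q) / suc q

module _ (G : Graph) where

  CycleIn : (S : Fin (N G) → Set) → Set
  CycleIn S = Σ ℕ λ j → Σ (Fin (suc (suc (suc j))) → Fin (N G)) λ c →
      Injective _≡_ _≡_ c
    × (∀ i → S (c i))
    × (∀ (i : Fin (suc (suc j))) → Adj G (c (inject₁ i)) (c (fsuc i)))
    × Adj G (c (fromℕ (suc (suc j)))) (c fzero)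

  InducedForest : (S : Fin (N G) → Set) → Set
  InducedForest S = ¬ CycleIn S

  InducedMaxDeg≤ : (S : Fin (N G) → Set) → ℕ → Set
  InducedMaxDeg≤ S r = ∀ v → S v → (ns : List (Fin (N G))) → Unique ns →
    All (λ u → S u × Adj G v u) ns → length ns ≤ r

  classSize : ∀ {q} → (Fin (N G) → Fin q) → Fin q → ℕ
  classSize f i = length (filter (λ v → f v ≟ i) (allFin (N G)))

  EqTreeColoring : ℕ → ℕ → Set
  EqTreeColoring q r = Σ (Fin (N G) → Fin q) λ f → ∀ (i : Fin q) →
      (classSize f i ≡ ⌊ N G / q ⌋ ⊎ classSize f i ≡ ⌈ N G / q ⌉)
    × InducedForest (λ v → f v ≡ i)
    × InducedMaxDeg≤ (λ v → f v ≡ i) r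

  IsStrongEqVertexArboricity : ℕ → ℕ → Set
  IsStrongEqVertexArboricity r x =
      (∀ q → x ≤ q → EqTreeColoring q r)
    × (∀ p → (∀ q → p ≤ q → EqTreeColoring q r) → x ≤ p)

side : ∀ m {n} → Fin (m + n) → Bool
side m v = toℕ v <ᵇ m

K : ℕ → ℕ → Graph
K m n = record
  { N = m + n
  ; Adj = λ u v → side m u ≢ side m v
  ; sym = λ ne eq → ne (Relation.Binary.PropositionalEquality.sym eq)
  ; irrefl = λ ne → ne Relation.Binary.PropositionalEquality.refl
  }

-- Condition on d: (i) neither n₁ nor n₂ is divisible by d, or
-- (ii) some nᵢ / ⌊nᵢ/d⌋ > d+1, written cross-multiplied as
--      (d+1) * ⌊nᵢ/d⌋ < nᵢ (so ⌊nᵢ/d⌋ = 0, i.e. "nᵢ/0 = ∞", counts as true).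

CondD : ℕ → ℕ → ℕ → Set
CondD n₁ n₂ d =
    (¬ (d ∣ n₁) × ¬ (d ∣ n₂))
  ⊎ ((suc d * ⌊ n₁ / d ⌋ < n₁) ⊎ (suc d * ⌊ n₂ / d ⌋ < n₂))

IsMinD : ℕ → ℕ → ℕ → ℕ → Set
IsMinD q n₁ n₂ d =
    ⌈ (n₁ + n₂) / q ⌉ ≤ d
  × CondD n₁ n₂ d
  × (∀ d' → ⌈ (n₁ + n₂) / q ⌉ ≤ d' → CondD n₁ n₂ d' → d ≤ d')

IsP : ℕ → ℕ → ℕ → ℕ → Set
IsP q n₁ n₂ x = Σ ℕ λ d → IsMinD q n₁ n₂ d × x ≡ ⌈ n₁ / d ⌉ + ⌈ n₂ / d ⌉

{-# OPTIONS --safe #-}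
-- An equitable (q,1)-tree-colouring of K_{m,n} is determined, up to relabelling vertices within
-- a part, by how many vertices of each part every colour class takes, and a class induces a
-- forest of maximum degree 1 iff it lies inside one part or has at most one vertex in each.
-- Once the class sizes ⌊N/q⌋ and ⌈N/q⌉ (N = m + n) are at least 3, such a colouring is thus
-- the same as cutting m into kA and n into kB blocks of these sizes with kA + kB = q. For
-- q = p - 1 either of the conditions (i), (ii) on d rules such a cut out. For q ≥ p all class
-- sizes are at most d, and below d the failure of (i) and (ii) (automatic at 1 and 3, as m = 3b
-- and n = 3c + 1) gives a part divisible by the class size and room to match the block count to
-- q; the remaining class size 2 is handled by parity, with one edge class when m and n are odd.

module Submission where

open import Defs hiding (sym; N)
open import Data.Nat
  using (ℕ; zero; suc; _+_; _*_; _∸_; _≤_; _<_; _<ᵇ_; _≡ᵇ_; z≤n; s≤s; z<s; s<s; s≤s⁻¹; _/_; _%_)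
open import Data.Nat.Properties
open import Data.Nat.DivMod using (m/n*n≤m; m≡m%n+[m/n]*n; m%n<n; m<n⇒m/n≡0)
open import Data.Nat.Divisibility using (_∣_; divides; _∣?_; ∣m+n∣m⇒∣n; n∣m*n; m∣m*n; 1∣_)
open import Data.Nat.Solver using (module +-*-Solver)
open import Algebra.Properties.CommutativeSemigroup +-commutativeSemigroup using (interchange)
open import Data.Bool using (Bool; true; false; not; _∧_; if_then_else_; T)
open import Data.Bool.Properties using (¬-not; not-¬; T-≡) renaming (_≟_ to _≟ᵇ_)
open import Data.Fin using (Fin; toℕ; fromℕ<) renaming (zero to fzero; suc to fsuc)
open import Data.Fin.Properties using (toℕ<n; toℕ-injective; toℕ-fromℕ<) renaming (_≟_ to _≟ᶠ_)
open import Data.List using (List; []; _∷_; length; filter; tabulate; allFin)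
open import Data.List.Membership.Propositional using (_∈_)
open import Data.List.Membership.Propositional.Properties using (∈-filter⁺; ∈-filter⁻; ∈-allFin; ∈-length)
open import Data.List.Relation.Unary.Any using (here; there)
open import Data.List.Relation.Unary.All using ([]; _∷_)
open import Data.List.Relation.Unary.AllPairs using ([]; _∷_)
open import Data.List.Relation.Unary.Unique.Propositional.Properties using (allFin⁺; filter⁺)
open import Data.Product using (Σ; ∃; ∃₂; _×_; _,_; proj₁; proj₂)
open import Data.Sum using (_⊎_; inj₁; inj₂)
import Data.Sum as Sum
open import Data.Empty using (⊥; ⊥-elim)
open import Function using (_∘_; Equivalence)
open import Level using (0ℓ)
open import Relation.Nullary using (¬_; Dec; yes; no; does; _×-dec_)
open import Relation.Nullary.Decidable using (¬?; _⊎-dec_)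
open import Relation.Unary using (Pred; Decidable)
open import Relation.Binary.PropositionalEquality
open +-*-Solver using (solve; _:+_; _:*_; _:=_; con)

fromBool : Bool → ℕ
fromBool true  = 1
fromBool false = 0

<ᵇ-true : ∀ {x a} → x < a → (x <ᵇ a) ≡ true
<ᵇ-true x<a = Equivalence.to T-≡ (<⇒<ᵇ x<a)

<ᵇ-+ : ∀ a x → (a + x <ᵇ a) ≡ false
<ᵇ-+ zero    x = refl
<ᵇ-+ (suc a) x = <ᵇ-+ a x

sumBelow : (ℕ → ℕ) → ℕ → ℕ
sumBelow s zero    = 0
sumBelow s (suc k) = s 0 + sumBelow (s ∘ suc) k

sumBelow-cong : ∀ {f g} k → (∀ {j} → j < k → f j ≡ g j) → sumBelow f k ≡ sumBelow g k
sumBelow-cong zero    f≗g = refl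
sumBelow-cong (suc k) f≗g = cong₂ _+_ (f≗g z<s) (sumBelow-cong k (f≗g ∘ s<s))

sumBelow-mono-≤ : ∀ {f g} k → (∀ {j} → j < k → f j ≤ g j) → sumBelow f k ≤ sumBelow g k
sumBelow-mono-≤ zero    f≤g = z≤n
sumBelow-mono-≤ (suc k) f≤g = +-mono-≤ (f≤g z<s) (sumBelow-mono-≤ k (f≤g ∘ s<s))

sumBelow-++ : ∀ s a b → sumBelow s (a + b) ≡ sumBelow s a + sumBelow (λ j → s (a + j)) b
sumBelow-++ s zero    b = refl
sumBelow-++ s (suc a) b =
  trans (cong (s 0 +_) (sumBelow-++ (s ∘ suc) a b)) (sym (+-assoc (s 0) _ _))

sumBelow-+ : ∀ f g k → sumBelow (λ j → f j + g j) k ≡ sumBelow f k + sumBelow g k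
sumBelow-+ f g zero    = refl
sumBelow-+ f g (suc k) =
  trans (cong (f 0 + g 0 +_) (sumBelow-+ (f ∘ suc) (g ∘ suc) k)) (interchange (f 0) (g 0) _ _)

sumBelow-*ʳ : ∀ f c k → sumBelow (λ j → f j * c) k ≡ sumBelow f k * c
sumBelow-*ʳ f c zero    = refl
sumBelow-*ʳ f c (suc k) =
  trans (cong (f 0 * c +_) (sumBelow-*ʳ (f ∘ suc) c k)) (sym (*-distribʳ-+ c (f 0) _))

sumBelow-const : ∀ c k → sumBelow (λ _ → c) k ≡ k * c
sumBelow-const c zero    = refl
sumBelow-const c (suc k) = cong (c +_) (sumBelow-const c k)

sumBelow-zero : ∀ {f} k → (∀ {j} → j < k → f j ≡ 0) → sumBelow f k ≡ 0
sumBelow-zero k f≗0 = trans (sumBelow-cong k f≗0) (trans (sumBelow-const 0 k) (*-zeroʳ k))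

sumBelow-≡ᵇ : ∀ {t} k → t < k → sumBelow (λ j → fromBool (t ≡ᵇ j)) k ≡ 1
sumBelow-≡ᵇ {zero}  (suc k) _         = cong suc (sumBelow-zero k (λ _ → refl))
sumBelow-≡ᵇ {suc t} (suc k) (s<s t<k) = sumBelow-≡ᵇ k t<k

sumBelow-<ᵇ : ∀ {r} k → r ≤ k → sumBelow (λ j → fromBool (j <ᵇ r)) k ≡ r
sumBelow-<ᵇ {zero}  k       _         = sumBelow-zero k (λ _ → refl)
sumBelow-<ᵇ {suc r} (suc k) (s≤s r≤k) = cong suc (sumBelow-<ᵇ k r≤k)

sumFin : ∀ {N} → (Fin N → ℕ) → ℕ
sumFin {zero}  f = 0
sumFin {suc N} f = f fzero + sumFin (f ∘ fsuc)

sumFin-cong : ∀ {N} {f g : Fin N → ℕ} → (∀ v → f v ≡ g v) → sumFin f ≡ sumFin g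
sumFin-cong {zero}  f≗g = refl
sumFin-cong {suc N} f≗g = cong₂ _+_ (f≗g fzero) (sumFin-cong (f≗g ∘ fsuc))

sumFin-+ : ∀ {N} (f g : Fin N → ℕ) → sumFin (λ v → f v + g v) ≡ sumFin f + sumFin g
sumFin-+ {zero}  f g = refl
sumFin-+ {suc N} f g =
  trans (cong (f fzero + g fzero +_) (sumFin-+ (f ∘ fsuc) (g ∘ fsuc))) (interchange (f fzero) (g fzero) _ _)

sumFin-toℕ : ∀ {N} (f : ℕ → ℕ) → sumFin {N} (f ∘ toℕ) ≡ sumBelow f N
sumFin-toℕ {zero}  f = refl
sumFin-toℕ {suc N} f = cong (f 0 +_) (sumFin-toℕ {N} (f ∘ suc))

sumBelow-sumFin : ∀ {N} (h : ℕ → Fin N → ℕ) k →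
  sumBelow (λ j → sumFin (h j)) k ≡ sumFin (λ v → sumBelow (λ j → h j v) k)
sumBelow-sumFin {zero}  h k = sumBelow-zero k (λ _ → refl)
sumBelow-sumFin {suc N} h k =
  trans (sumBelow-+ (λ j → h j fzero) _ k)
        (cong (sumBelow (λ j → h j fzero) k +_) (sumBelow-sumFin (λ j → h j ∘ fsuc) k))

length-filter-tabulate : ∀ {A : Set} {N} {P : Pred A 0ℓ} (P? : Decidable P) (τ : Fin N → A) →
  length (filter P? (tabulate τ)) ≡ sumFin (λ v → fromBool (does (P? (τ v))))
length-filter-tabulate {N = zero}  P? τ = refl
length-filter-tabulate {N = suc N} P? τ with does (P? (τ fzero))
... | true  = cong suc (length-filter-tabulate P? (τ ∘ fsuc))
... | false = length-filter-tabulate P? (τ ∘ fsuc)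

∈-length≤1⇒≡ : ∀ {A : Set} {xs : List A} {u v} → length xs ≤ 1 → u ∈ xs → v ∈ xs → u ≡ v
∈-length≤1⇒≡ {xs = _ ∷ []}    _         (here refl) (here refl) = refl
∈-length≤1⇒≡ {xs = _ ∷ []}    _         (there ())  _
∈-length≤1⇒≡ {xs = _ ∷ []}    _         _           (there ())
∈-length≤1⇒≡ {xs = _ ∷ _ ∷ _} (s≤s ())  _           _

module _ {N} {P : Pred (Fin N) 0ℓ} (P? : Decidable P) where

  count : ℕ
  count = length (filter P? (allFin N))

  count≡sumFin : count ≡ sumFin (λ v → fromBool (does (P? v)))
  count≡sumFin = length-filter-tabulate P? (λ v → v)

  private
    ∈-members : ∀ {v} → P v → v ∈ filter P? (allFin N)
    ∈-members Pv = ∈-filter⁺ P? (∈-allFin _) Pv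

  count-pos : ∀ {v} → P v → 1 ≤ count
  count-pos Pv = ∈-length (∈-members Pv)

  count≤1⇒≡ : count ≤ 1 → ∀ {u v} → P u → P v → u ≡ v
  count≤1⇒≡ c≤1 Pu Pv = ∈-length≤1⇒≡ c≤1 (∈-members Pu) (∈-members Pv)

  count-witness : 1 ≤ count → ∃ P
  count-witness c≥1 with filter P? (allFin N) in eq
  ... | v ∷ _ = v , proj₂ (∈-filter⁻ P? {xs = allFin N} (subst (v ∈_) (sym eq) (here refl)))

  count-witness₂ : 2 ≤ count → ∃₂ λ u v → u ≢ v × P u × P v
  count-witness₂ c≥2 with filter P? (allFin N) in eq | filter⁺ P? (allFin⁺ N)
  ... | u ∷ v ∷ _ | (u≢v ∷ _) ∷ _ =
    let member = λ {w} (w∈ : w ∈ filter P? (allFin N)) → proj₂ (∈-filter⁻ P? {xs = allFin N} w∈)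
    in u , v , u≢v , member (subst (u ∈_) (sym eq) (here refl))
                   , member (subst (v ∈_) (sym eq) (there (here refl)))
  count-witness₂ (s≤s ()) | _ ∷ [] | _

opposite-sides : ∀ {m n} {u v w : Fin (m + n)} → Adj (K m n) u v → Adj (K m n) w v → side m u ≡ side m w
opposite-sides u~v w~v = trans (¬-not u~v) (sym (¬-not w~v))

module _ {m n : ℕ} (S : Fin (m + n) → Set) where

  oneSided⇒forest : ∀ {σ} → (∀ {v} → S v → side m v ≡ σ) → InducedForest (K m n) S
  oneSided⇒forest onσ (_ , _ , _ , inS , adj , _) =
    adj fzero (trans (onσ (inS fzero)) (sym (onσ (inS (fsuc fzero)))))

  oneSided⇒maxDeg≤ : ∀ {σ r} → (∀ {v} → S v → side m v ≡ σ) → InducedMaxDeg≤ (K m n) S r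
  oneSided⇒maxDeg≤ onσ v Sv []      _ _                = z≤n
  oneSided⇒maxDeg≤ onσ v Sv (u ∷ _) _ ((Su , v~u) ∷ _) = ⊥-elim (v~u (trans (onσ Sv) (sym (onσ Su))))

  SideInjective : Set
  SideInjective = ∀ {u v} → S u → S v → side m u ≡ side m v → u ≡ v

  sideInjective⇒forest : SideInjective → InducedForest (K m n) S
  sideInjective⇒forest inj (_ , c , c-inj , inS , adj , _)
    with c-inj {fzero} {fsuc (fsuc fzero)}
           (inj (inS _) (inS _) (opposite-sides {m} {n} (adj fzero) (adj (fsuc fzero) ∘ sym)))
  ... | ()

  sideInjective⇒maxDeg≤1 : SideInjective → InducedMaxDeg≤ (K m n) S 1
  sideInjective⇒maxDeg≤1 inj v Sv []          _               _ = z≤n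
  sideInjective⇒maxDeg≤1 inj v Sv (_ ∷ [])    _               _ = s≤s z≤n
  sideInjective⇒maxDeg≤1 inj v Sv (u ∷ w ∷ _) ((u≢w ∷ _) ∷ _) ((Su , v~u) ∷ (Sw , v~w) ∷ _) =
    ⊥-elim (u≢w (inj Su Sw (opposite-sides {m} {n} (v~u ∘ sym) (v~w ∘ sym))))

  maxDeg≤1⇒no-cherry : InducedMaxDeg≤ (K m n) S 1 → ∀ {u v w} → S v → S u → S w → u ≢ w →
    Adj (K m n) v u → Adj (K m n) v w → ⊥
  maxDeg≤1⇒no-cherry deg≤1 Sv Su Sw u≢w v~u v~w =
    <-irrefl refl (deg≤1 _ Sv (_ ∷ _ ∷ []) ((u≢w ∷ []) ∷ [] ∷ []) ((Su , v~u) ∷ (Sw , v~w) ∷ []))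

KDeg≤1 : ℕ → ℕ → Set
KDeg≤1 a b = (a ≡ 0 ⊎ b ≡ 0) ⊎ (a ≤ 1 × b ≤ 1)

KDeg≤1-intro : ∀ {a b} → (2 ≤ a → 1 ≤ b → ⊥) → (1 ≤ a → 2 ≤ b → ⊥) → KDeg≤1 a b
KDeg≤1-intro {zero}        {_}           _    _    = inj₁ (inj₁ refl)
KDeg≤1-intro {suc _}       {zero}        _    _    = inj₁ (inj₂ refl)
KDeg≤1-intro {suc zero}    {suc zero}    _    _    = inj₂ (s≤s z≤n , s≤s z≤n)
KDeg≤1-intro {suc (suc _)} {suc _}       ¬2,1 _    = ⊥-elim (¬2,1 (s≤s (s≤s z≤n)) (s≤s z≤n))
KDeg≤1-intro {suc zero}    {suc (suc _)} _    ¬1,2 = ⊥-elim (¬1,2 (s≤s z≤n) (s≤s (s≤s z≤n)))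

does-≟ᶠ : ∀ {q} (u i : Fin q) → does (u ≟ᶠ i) ≡ (toℕ u ≡ᵇ toℕ i)
does-≟ᶠ fzero    fzero    = refl
does-≟ᶠ fzero    (fsuc i) = refl
does-≟ᶠ (fsuc u) fzero    = refl
does-≟ᶠ (fsuc u) (fsuc i) = does-≟ᶠ u i

count-side : ∀ {m n} σ → count (λ (v : Fin (m + n)) → side m v ≟ᵇ σ) ≡ (if σ then m else n)
count-side {m} {n} σ = begin
  count (λ (v : Fin (m + n)) → side m v ≟ᵇ σ)
    ≡⟨ count≡sumFin (λ (v : Fin (m + n)) → side m v ≟ᵇ σ) ⟩
  sumFin {m + n} (g ∘ toℕ)
    ≡⟨ sumFin-toℕ {m + n} g ⟩
  sumBelow g (m + n)
    ≡⟨ sumBelow-++ g m n ⟩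
  sumBelow g m + sumBelow (λ x → g (m + x)) n
    ≡⟨ cong₂ _+_ (sumBelow-cong m (λ x<m → cong (λ b → fromBool (does (b ≟ᵇ σ))) (<ᵇ-true x<m)))
                 (sumBelow-cong n (λ {x} _ → cong (λ b → fromBool (does (b ≟ᵇ σ))) (<ᵇ-+ m x))) ⟩
  sumBelow (λ _ → fromBool (does (true ≟ᵇ σ))) m + sumBelow (λ _ → fromBool (does (false ≟ᵇ σ))) n
    ≡⟨ cong₂ _+_ (sumBelow-const _ m) (sumBelow-const _ n) ⟩
  m * fromBool (does (true ≟ᵇ σ)) + n * fromBool (does (false ≟ᵇ σ))
    ≡⟨ by-side σ ⟩
  (if σ then m else n) ∎
  where
  open ≡-Reasoning
  g : ℕ → ℕ
  g x = fromBool (does ((x <ᵇ m) ≟ᵇ σ))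
  by-side : ∀ σ → m * fromBool (does (true ≟ᵇ σ)) + n * fromBool (does (false ≟ᵇ σ)) ≡ (if σ then m else n)
  by-side true  = trans (cong₂ _+_ (*-identityʳ m) (*-zeroʳ n)) (+-identityʳ m)
  by-side false = cong₂ _+_ (*-zeroʳ m) (*-identityʳ n)

module ColourClasses {m n q} (f : Fin (m + n) → Fin q) where

  inPart? : ∀ σ j (v : Fin (m + n)) → Dec (side m v ≡ σ × toℕ (f v) ≡ j)
  inPart? σ j v = side m v ≟ᵇ σ ×-dec toℕ (f v) ≟ j

  partSize : Bool → ℕ → ℕ
  partSize σ j = count (inPart? σ j)

  classSize-parts : ∀ i → classSize (K m n) f i ≡ partSize true (toℕ i) + partSize false (toℕ i)
  classSize-parts i = begin
    count (λ v → f v ≟ᶠ i)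
      ≡⟨ count≡sumFin (λ v → f v ≟ᶠ i) ⟩
    sumFin (λ v → fromBool (does (f v ≟ᶠ i)))
      ≡⟨ sumFin-cong (λ v → by-side (side m v) (f v)) ⟩
    sumFin (λ v → inPart true v + inPart false v)
      ≡⟨ sumFin-+ (inPart true) (inPart false) ⟩
    sumFin (inPart true) + sumFin (inPart false)
      ≡⟨ sym (cong₂ _+_ (count≡sumFin (inPart? true (toℕ i))) (count≡sumFin (inPart? false (toℕ i)))) ⟩
    partSize true (toℕ i) + partSize false (toℕ i) ∎
    where
    open ≡-Reasoning
    inPart : Bool → Fin (m + n) → ℕ
    inPart σ v = fromBool (does (side m v ≟ᵇ σ) ∧ (toℕ (f v) ≡ᵇ toℕ i))
    by-side : ∀ b w → fromBool (does (w ≟ᶠ i)) ≡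
      fromBool (does (b ≟ᵇ true) ∧ (toℕ w ≡ᵇ toℕ i)) + fromBool (does (b ≟ᵇ false) ∧ (toℕ w ≡ᵇ toℕ i))
    by-side true  w rewrite does-≟ᶠ w i = sym (+-identityʳ _)
    by-side false w rewrite does-≟ᶠ w i = refl

  sumBelow-partSize : ∀ σ → sumBelow (partSize σ) q ≡ count (λ v → side m v ≟ᵇ σ)
  sumBelow-partSize σ = begin
    sumBelow (partSize σ) q
      ≡⟨ sumBelow-cong q (λ {j} _ → count≡sumFin (inPart? σ j)) ⟩
    sumBelow (λ j → sumFin (λ v → fromBool (does (side m v ≟ᵇ σ) ∧ (toℕ (f v) ≡ᵇ j)))) q
      ≡⟨ sumBelow-sumFin (λ j v → fromBool (does (side m v ≟ᵇ σ) ∧ (toℕ (f v) ≡ᵇ j))) q ⟩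
    sumFin (λ v → sumBelow (λ j → fromBool (does (side m v ≟ᵇ σ) ∧ (toℕ (f v) ≡ᵇ j))) q)
      ≡⟨ sumFin-cong (λ v → fibre (does (side m v ≟ᵇ σ)) (toℕ<n (f v))) ⟩
    sumFin (λ v → fromBool (does (side m v ≟ᵇ σ)))
      ≡⟨ sym (count≡sumFin (λ v → side m v ≟ᵇ σ)) ⟩
    count (λ v → side m v ≟ᵇ σ) ∎
    where
    open ≡-Reasoning
    fibre : ∀ b {t} → t < q → sumBelow (λ j → fromBool (b ∧ (t ≡ᵇ j))) q ≡ fromBool b
    fibre true  t<q = sumBelow-≡ᵇ q t<q
    fibre false _   = sumBelow-zero q (λ _ → refl)

  partSizes-shape : ∀ {j} (j<q : j < q) → InducedMaxDeg≤ (K m n) (λ v → f v ≡ fromℕ< j<q) 1 →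
    KDeg≤1 (partSize true j) (partSize false j)
  partSizes-shape {j} j<q deg≤1 = KDeg≤1-intro (crowded true) (λ a≥1 b≥2 → crowded false b≥2 a≥1)
    where
    inClass : ∀ {v} → toℕ (f v) ≡ j → f v ≡ fromℕ< j<q
    inClass e = toℕ-injective (trans e (sym (toℕ-fromℕ< j<q)))
    crowded : ∀ σ → 2 ≤ partSize σ j → 1 ≤ partSize (not σ) j → ⊥
    crowded σ two one with count-witness₂ (inPart? σ j) two | count-witness (inPart? (not σ) j) one
    ... | u , w , u≢w , (u∈σ , fu) , (w∈σ , fw) | v , (v∉σ , fv) =
      maxDeg≤1⇒no-cherry {m} {n} _ deg≤1 (inClass fv) (inClass fu) (inClass fw) u≢w (across u∈σ) (across w∈σ)
      where
      across : ∀ {x} → side m x ≡ σ → side m v ≢ side m x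
      across x∈σ v≡x = not-¬ x∈σ (trans (sym v≡x) v∉σ)

  partSize≡0⇒avoids : ∀ {σ i v} → partSize σ (toℕ i) ≡ 0 → f v ≡ i → side m v ≡ not σ
  partSize≡0⇒avoids {σ} {i} none fv =
    ¬-not (λ v∈σ → n≮0 (subst (1 ≤_) none (count-pos (inPart? σ (toℕ i)) (v∈σ , cong toℕ fv))))

  class-tree : ∀ i → KDeg≤1 (partSize true (toℕ i)) (partSize false (toℕ i)) →
    InducedForest (K m n) (λ v → f v ≡ i) × InducedMaxDeg≤ (K m n) (λ v → f v ≡ i) 1
  class-tree i (inj₁ (inj₁ noA)) =
    oneSided⇒forest {m} {n} _ (partSize≡0⇒avoids noA) , oneSided⇒maxDeg≤ {m} {n} _ (partSize≡0⇒avoids noA)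
  class-tree i (inj₁ (inj₂ noB)) =
    oneSided⇒forest {m} {n} _ (partSize≡0⇒avoids noB) , oneSided⇒maxDeg≤ {m} {n} _ (partSize≡0⇒avoids noB)
  class-tree i (inj₂ (a≤1 , b≤1)) = sideInjective⇒forest {m} {n} _ inj , sideInjective⇒maxDeg≤1 {m} {n} _ inj
    where
    at-most-one : ∀ σ → partSize σ (toℕ i) ≤ 1
    at-most-one true  = a≤1
    at-most-one false = b≤1
    inj : SideInjective {m} {n} (λ v → f v ≡ i)
    inj {u} fu fw u≡w =
      count≤1⇒≡ (inPart? (side m u) (toℕ i)) (at-most-one (side m u)) (refl , cong toℕ fu) (sym u≡w , cong toℕ fw)

-- inA j and inB j are the numbers of vertices of colour j in the first and in the second part
record Profile (m n q L T : ℕ) : Set where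
  field
    inA inB : ℕ → ℕ
    sum-inA : sumBelow inA q ≡ m
    sum-inB : sumBelow inB q ≡ n
    size    : ∀ {j} → j < q → inA j + inB j ≡ L ⊎ inA j + inB j ≡ T
    shape   : ∀ {j} → j < q → KDeg≤1 (inA j) (inB j)

EqProfile : ℕ → ℕ → ℕ → Set
EqProfile m n q = Profile m n q ⌊ (m + n) / q ⌋ ⌈ (m + n) / q ⌉

coloring⇒profile : ∀ {m n q} → EqTreeColoring (K m n) q 1 → EqProfile m n q
coloring⇒profile {m} {n} {q} (f , classes) = record
  { inA     = partSize true
  ; inB     = partSize false
  ; sum-inA = trans (sumBelow-partSize true) (count-side {m} {n} true)
  ; sum-inB = trans (sumBelow-partSize false) (count-side {m} {n} false)
  ; size    = λ j<q → Sum.map (trans (parts j<q)) (trans (parts j<q)) (proj₁ (classes (fromℕ< j<q)))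
  ; shape   = λ j<q → partSizes-shape j<q (proj₂ (proj₂ (classes (fromℕ< j<q))))
  }
  where
  open ColourClasses {m} {n} f
  parts : ∀ {j} (j<q : j < q) → partSize true j + partSize false j ≡ classSize (K m n) f (fromℕ< j<q)
  parts j<q = trans (cong (λ t → partSize true t + partSize false t) (sym (toℕ-fromℕ< j<q)))
                    (sym (classSize-parts (fromℕ< j<q)))

-- bucket s k x is the index of the block containing x when [0, s 0 + ... + s (k-1)) is cut
-- into consecutive blocks of lengths s 0, s 1, ..., s (k-1)
bucket : (ℕ → ℕ) → ℕ → ℕ → ℕ
bucket s zero    x = 0
bucket s (suc k) x = if x <ᵇ s 0 then 0 else suc (bucket (s ∘ suc) k (x ∸ s 0))

bucket-< : ∀ s k {x} → x < sumBelow s k → bucket s k x < k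
bucket-< s (suc k) {x} x<Σ with x <ᵇ s 0 in eq
... | true  = z<s
... | false = s<s (bucket-< (s ∘ suc) k (subst (x ∸ s 0 <_) (m+n∸m≡n (s 0) _) (∸-monoˡ-< x<Σ s0≤x)))
  where
  s0≤x : s 0 ≤ x
  s0≤x = ≮⇒≥ (λ x<s0 → subst T eq (<⇒<ᵇ x<s0))

sumBelow-bucket : ∀ (g : ℕ → ℕ) s k → sumBelow (g ∘ bucket s (suc k)) (sumBelow s (suc k)) ≡
  s 0 * g 0 + sumBelow (g ∘ suc ∘ bucket (s ∘ suc) k) (sumBelow (s ∘ suc) k)
sumBelow-bucket g s k = begin
  sumBelow (g ∘ bucket s (suc k)) (s 0 + sumBelow (s ∘ suc) k)
    ≡⟨ sumBelow-++ (g ∘ bucket s (suc k)) (s 0) _ ⟩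
  sumBelow (g ∘ bucket s (suc k)) (s 0) + sumBelow (λ x → g (bucket s (suc k) (s 0 + x))) (sumBelow (s ∘ suc) k)
    ≡⟨ cong₂ _+_ (sumBelow-cong (s 0) first-block)
                 (sumBelow-cong (sumBelow (s ∘ suc) k) (λ {x} _ → later-blocks x)) ⟩
  sumBelow (λ _ → g 0) (s 0) + sumBelow (g ∘ suc ∘ bucket (s ∘ suc) k) (sumBelow (s ∘ suc) k)
    ≡⟨ cong₂ _+_ (sumBelow-const (g 0) (s 0)) refl ⟩
  s 0 * g 0 + sumBelow (g ∘ suc ∘ bucket (s ∘ suc) k) (sumBelow (s ∘ suc) k) ∎
  where
  open ≡-Reasoning
  first-block : ∀ {x} → x < s 0 → g (bucket s (suc k) x) ≡ g 0
  first-block x<s0 rewrite <ᵇ-true x<s0 = refl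
  later-blocks : ∀ x → g (bucket s (suc k) (s 0 + x)) ≡ g (suc (bucket (s ∘ suc) k x))
  later-blocks x rewrite <ᵇ-+ (s 0) x | m+n∸m≡n (s 0) x = refl

count-bucket : ∀ s k {j} → j < k → sumBelow (λ x → fromBool (bucket s k x ≡ᵇ j)) (sumBelow s k) ≡ s j
count-bucket s (suc k) {zero} _ =
  trans (sumBelow-bucket (λ b → fromBool (b ≡ᵇ 0)) s k)
        (trans (cong₂ _+_ (*-identityʳ (s 0)) (sumBelow-zero (sumBelow (s ∘ suc) k) (λ _ → refl)))
               (+-identityʳ (s 0)))
count-bucket s (suc k) {suc j} (s<s j<k) =
  trans (sumBelow-bucket (λ b → fromBool (b ≡ᵇ suc j)) s k)
        (trans (cong₂ _+_ (*-zeroʳ (s 0)) refl) (count-bucket (s ∘ suc) k j<k))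

module BlockColouring {m n q a b : ℕ} (P : Profile m n q a b) where
  open Profile P

  colour : ℕ → ℕ
  colour x = if x <ᵇ m then bucket inA q x else bucket inB q (x ∸ m)

  colour-< : ∀ {x} → x < m + n → colour x < q
  colour-< {x} x<m+n with x <ᵇ m in eq
  ... | true  = bucket-< inA q (subst (x <_) (sym sum-inA) (<ᵇ⇒< x m (Equivalence.from T-≡ eq)))
  ... | false = bucket-< inB q (subst (x ∸ m <_) (trans (m+n∸m≡n m n) (sym sum-inB)) (∸-monoˡ-< x<m+n m≤x))
    where
    m≤x : m ≤ x
    m≤x = ≮⇒≥ (λ x<m → subst T eq (<⇒<ᵇ x<m))

  f : Fin (m + n) → Fin q
  f v = fromℕ< (colour-< (toℕ<n v))

  open ColourClasses {m} {n} f

  partSize-blocks : ∀ σ j → partSize σ j ≡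
    sumBelow (λ x → fromBool (does (true ≟ᵇ σ) ∧ (bucket inA q x ≡ᵇ j))) m +
    sumBelow (λ x → fromBool (does (false ≟ᵇ σ) ∧ (bucket inB q x ≡ᵇ j))) n
  partSize-blocks σ j = begin
    partSize σ j
      ≡⟨ count≡sumFin (inPart? σ j) ⟩
    sumFin (λ v → fromBool (does (side m v ≟ᵇ σ) ∧ (toℕ (f v) ≡ᵇ j)))
      ≡⟨ sumFin-cong (λ v → cong (λ c → fromBool (does (side m v ≟ᵇ σ) ∧ (c ≡ᵇ j)))
                                 (toℕ-fromℕ< (colour-< (toℕ<n v)))) ⟩
    sumFin {m + n} (g ∘ toℕ)
      ≡⟨ sumFin-toℕ {m + n} g ⟩
    sumBelow g (m + n)
      ≡⟨ sumBelow-++ g m n ⟩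
    sumBelow g m + sumBelow (λ x → g (m + x)) n
      ≡⟨ cong₂ _+_ (sumBelow-cong m first-part) (sumBelow-cong n (λ {x} _ → second-part x)) ⟩
    sumBelow (λ x → fromBool (does (true ≟ᵇ σ) ∧ (bucket inA q x ≡ᵇ j))) m +
    sumBelow (λ x → fromBool (does (false ≟ᵇ σ) ∧ (bucket inB q x ≡ᵇ j))) n ∎
    where
    open ≡-Reasoning
    g : ℕ → ℕ
    g x = fromBool (does ((x <ᵇ m) ≟ᵇ σ) ∧ (colour x ≡ᵇ j))
    first-part : ∀ {x} → x < m → g x ≡ fromBool (does (true ≟ᵇ σ) ∧ (bucket inA q x ≡ᵇ j))
    first-part x<m rewrite <ᵇ-true x<m = refl
    second-part : ∀ x → g (m + x) ≡ fromBool (does (false ≟ᵇ σ) ∧ (bucket inB q x ≡ᵇ j))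
    second-part x rewrite <ᵇ-+ m x | m+n∸m≡n m x = refl

  partSize-inA : ∀ {j} → j < q → partSize true j ≡ inA j
  partSize-inA {j} j<q = begin
    partSize true j
      ≡⟨ partSize-blocks true j ⟩
    sumBelow (λ x → fromBool (bucket inA q x ≡ᵇ j)) m + sumBelow (λ _ → 0) n
      ≡⟨ cong₂ _+_ (cong (sumBelow _) (sym sum-inA)) (sumBelow-zero n (λ _ → refl)) ⟩
    sumBelow (λ x → fromBool (bucket inA q x ≡ᵇ j)) (sumBelow inA q) + 0
      ≡⟨ +-identityʳ _ ⟩
    sumBelow (λ x → fromBool (bucket inA q x ≡ᵇ j)) (sumBelow inA q)
      ≡⟨ count-bucket inA q j<q ⟩
    inA j ∎
    where open ≡-Reasoning

  partSize-inB : ∀ {j} → j < q → partSize false j ≡ inB j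
  partSize-inB {j} j<q = begin
    partSize false j
      ≡⟨ partSize-blocks false j ⟩
    sumBelow (λ _ → 0) m + sumBelow (λ x → fromBool (bucket inB q x ≡ᵇ j)) n
      ≡⟨ cong₂ _+_ (sumBelow-zero m (λ _ → refl)) (cong (sumBelow _) (sym sum-inB)) ⟩
    sumBelow (λ x → fromBool (bucket inB q x ≡ᵇ j)) (sumBelow inB q)
      ≡⟨ count-bucket inB q j<q ⟩
    inB j ∎
    where open ≡-Reasoning

profile⇒coloring : ∀ {m n q} → EqProfile m n q → EqTreeColoring (K m n) q 1
profile⇒coloring {m} {n} {q} P = f , λ i → size-of i , class-tree i (shape-of i)
  where
  open Profile P
  open BlockColouring P
  open ColourClasses {m} {n} f
  parts : ∀ i → classSize (K m n) f i ≡ inA (toℕ i) + inB (toℕ i)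
  parts i = trans (classSize-parts i) (cong₂ _+_ (partSize-inA (toℕ<n i)) (partSize-inB (toℕ<n i)))
  size-of : ∀ i → classSize (K m n) f i ≡ ⌊ (m + n) / q ⌋ ⊎ classSize (K m n) f i ≡ ⌈ (m + n) / q ⌉
  size-of i = Sum.map (trans (parts i)) (trans (parts i)) (size (toℕ<n i))
  shape-of : ∀ i → KDeg≤1 (partSize true (toℕ i)) (partSize false (toℕ i))
  shape-of i = subst₂ KDeg≤1 (sym (partSize-inA (toℕ<n i))) (sym (partSize-inB (toℕ<n i))) (shape (toℕ<n i))

⌊/⌋*≤ : ∀ {a q} → 1 ≤ q → ⌊ a / q ⌋ * q ≤ a
⌊/⌋*≤ {a} {suc q} _ = m/n*n≤m a (suc q)

<1+⌊/⌋* : ∀ {a q} → 1 ≤ q → a < suc ⌊ a / q ⌋ * q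
<1+⌊/⌋* {a} {suc q} _ = begin-strict
  a                               ≡⟨ m≡m%n+[m/n]*n a (suc q) ⟩
  a % suc q + (a / suc q) * suc q <⟨ +-monoˡ-< _ (m%n<n a (suc q)) ⟩
  suc q + (a / suc q) * suc q     ∎
  where open ≤-Reasoning

≤⌈/⌉* : ∀ {a q} → 1 ≤ q → a ≤ ⌈ a / q ⌉ * q
≤⌈/⌉* {a} {suc q} _ =
  +-cancelʳ-≤ q a _
    (s≤s⁻¹ (≤-trans (<1+⌊/⌋* {a + q} {suc q} (s≤s z≤n)) (≤-reflexive (cong suc (+-comm q _)))))

⌈/⌉*< : ∀ {a q} → 1 ≤ q → ⌈ a / q ⌉ * q < a + q
⌈/⌉*< {a} {suc q} _ = ≤-<-trans (m/n*n≤m (a + q) (suc q)) (+-monoʳ-< a (n<1+n q))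

⌊/⌋-greatest : ∀ {a q t} → 1 ≤ q → t * q ≤ a → t ≤ ⌊ a / q ⌋
⌊/⌋-greatest {q = q} {t} q≥1 tq≤a = s≤s⁻¹ (*-cancelʳ-< q t _ (≤-<-trans tq≤a (<1+⌊/⌋* q≥1)))

⌈/⌉-least : ∀ {a q t} → 1 ≤ q → a ≤ t * q → ⌈ a / q ⌉ ≤ t
⌈/⌉-least {q = q} {t} q≥1 a≤tq =
  s≤s⁻¹ (*-cancelʳ-< q _ (suc t)
    (<-≤-trans (⌈/⌉*< q≥1) (≤-trans (+-monoˡ-≤ q a≤tq) (≤-reflexive (+-comm (t * q) q)))))

⌊/⌋≤⌈/⌉ : ∀ {a q} → 1 ≤ q → ⌊ a / q ⌋ ≤ ⌈ a / q ⌉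
⌊/⌋≤⌈/⌉ {a} {suc q} q≥1 = *-cancelʳ-≤ _ _ (suc q) (≤-trans (⌊/⌋*≤ {a} q≥1) (≤⌈/⌉* {a} q≥1))

⌈/⌉≤1+⌊/⌋ : ∀ {a q} → 1 ≤ q → ⌈ a / q ⌉ ≤ suc ⌊ a / q ⌋
⌈/⌉≤1+⌊/⌋ q≥1 = ⌈/⌉-least q≥1 (<⇒≤ (<1+⌊/⌋* q≥1))

⌈/⌉≡⌊/⌋⊎1+⌊/⌋ : ∀ {a q} → 1 ≤ q → ⌈ a / q ⌉ ≡ ⌊ a / q ⌋ ⊎ ⌈ a / q ⌉ ≡ suc ⌊ a / q ⌋
⌈/⌉≡⌊/⌋⊎1+⌊/⌋ q≥1 with m≤n⇒m<n∨m≡n (⌈/⌉≤1+⌊/⌋ q≥1)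
... | inj₁ ⌈⌉≤⌊⌋ = inj₁ (≤-antisym (s≤s⁻¹ ⌈⌉≤⌊⌋) (⌊/⌋≤⌈/⌉ q≥1))
... | inj₂ ⌈⌉≡1+⌊⌋ = inj₂ ⌈⌉≡1+⌊⌋

⌈/⌉≡⌊/⌋⇒*≡ : ∀ {a q} → 1 ≤ q → ⌈ a / q ⌉ ≡ ⌊ a / q ⌋ → q * ⌊ a / q ⌋ ≡ a
⌈/⌉≡⌊/⌋⇒*≡ {a} {q} q≥1 ⌈⌉≡⌊⌋ =
  trans (*-comm q _) (≤-antisym (⌊/⌋*≤ q≥1) (subst (λ t → a ≤ t * q) ⌈⌉≡⌊⌋ (≤⌈/⌉* q≥1)))

∤⇒⌊/⌋<⌈/⌉ : ∀ {a q} → 1 ≤ q → ¬ q ∣ a → ⌊ a / q ⌋ < ⌈ a / q ⌉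
∤⇒⌊/⌋<⌈/⌉ {a} {q} q≥1 q∤a with ⌈/⌉≡⌊/⌋⊎1+⌊/⌋ {a} q≥1
... | inj₁ ⌈⌉≡⌊⌋   = ⊥-elim (q∤a (divides ⌊ a / q ⌋ (sym (trans (*-comm _ q) (⌈/⌉≡⌊/⌋⇒*≡ q≥1 ⌈⌉≡⌊⌋)))))
... | inj₂ ⌈⌉≡1+⌊⌋ = ≤-reflexive (sym ⌈⌉≡1+⌊⌋)

-- a can be cut into k blocks whose sizes lie between L and T
Fits : ℕ → ℕ → ℕ → ℕ → Set
Fits k L T a = k * L ≤ a × a ≤ k * T

-- q classes with sizes between L and T, kA of them inside the first part and kB inside the second
Split : ℕ → ℕ → ℕ → ℕ → ℕ → Set
Split m n q L T = Σ ℕ λ kA → Σ ℕ λ kB → kA + kB ≡ q × Fits kA L T m × Fits kB L T n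

fits⇒blocks : ∀ {k L T a} → T ≡ L ⊎ T ≡ suc L → Fits k L T a →
  Σ (ℕ → ℕ) λ s → sumBelow s k ≡ a × (∀ j → s j ≡ L ⊎ s j ≡ T)
fits⇒blocks {k} {L} (inj₁ refl) (kL≤a , a≤kL) =
  (λ _ → L) , trans (sumBelow-const L k) (≤-antisym kL≤a a≤kL) , λ _ → inj₁ refl
fits⇒blocks {k} {L} {a = a} (inj₂ refl) (kL≤a , a≤k[1+L]) = s , sum-s , size-s
  where
  r : ℕ
  r = a ∸ k * L
  s : ℕ → ℕ
  s j = L + fromBool (j <ᵇ r)
  r≤k : r ≤ k
  r≤k = ≤-trans (∸-monoˡ-≤ (k * L) a≤k[1+L])
                (≤-reflexive (trans (cong (_∸ k * L) (*-suc k L)) (m+n∸n≡m k (k * L))))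
  sum-s : sumBelow s k ≡ a
  sum-s = begin
    sumBelow s k
      ≡⟨ sumBelow-+ (λ _ → L) (λ j → fromBool (j <ᵇ r)) k ⟩
    sumBelow (λ _ → L) k + sumBelow (λ j → fromBool (j <ᵇ r)) k
      ≡⟨ cong₂ _+_ (sumBelow-const L k) (sumBelow-<ᵇ k r≤k) ⟩
    k * L + r
      ≡⟨ m+[n∸m]≡n kL≤a ⟩
    a ∎
    where open ≡-Reasoning
  size-s : ∀ j → s j ≡ L ⊎ s j ≡ suc L
  size-s j with j <ᵇ r
  ... | true  = inj₂ (+-comm L 1)
  ... | false = inj₁ (+-identityʳ L)

split⇒profile : ∀ {m n q L T} → T ≡ L ⊎ T ≡ suc L → Split m n q L T → Profile m n q L T
split⇒profile {m} {n} {L = L} {T} T≈L (kA , kB , refl , fitsA , fitsB)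
  with fits⇒blocks {kA} T≈L fitsA | fits⇒blocks {kB} T≈L fitsB
... | sA , ΣsA≡m , sizeA | sB , ΣsB≡n , sizeB = record
  { inA = inA ; inB = inB ; sum-inA = sum-inA ; sum-inB = sum-inB ; size = size ; shape = shape }
  where
  inA inB : ℕ → ℕ
  inA j = if j <ᵇ kA then sA j else 0
  inB j = if j <ᵇ kA then 0 else sB (j ∸ kA)
  sum-inA : sumBelow inA (kA + kB) ≡ m
  sum-inA = begin
    sumBelow inA (kA + kB)                                  ≡⟨ sumBelow-++ inA kA kB ⟩
    sumBelow inA kA + sumBelow (λ j → inA (kA + j)) kB
      ≡⟨ cong₂ _+_ (sumBelow-cong kA (λ {j} j<kA → cong (λ b → if b then sA j else 0) (<ᵇ-true j<kA)))
                   (sumBelow-zero kB (λ {j} _ → cong (λ b → if b then sA (kA + j) else 0) (<ᵇ-+ kA j))) ⟩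
    sumBelow sA kA + 0                                      ≡⟨ +-identityʳ _ ⟩
    sumBelow sA kA                                          ≡⟨ ΣsA≡m ⟩
    m                                                       ∎
    where open ≡-Reasoning
  sum-inB : sumBelow inB (kA + kB) ≡ n
  sum-inB = begin
    sumBelow inB (kA + kB)                                  ≡⟨ sumBelow-++ inB kA kB ⟩
    sumBelow inB kA + sumBelow (λ j → inB (kA + j)) kB
      ≡⟨ cong₂ _+_ (sumBelow-zero kA (λ {j} j<kA → cong (λ b → if b then 0 else sB (j ∸ kA)) (<ᵇ-true j<kA)))
                   (sumBelow-cong kB (λ {j} _ → trans (cong (λ b → if b then 0 else sB (kA + j ∸ kA)) (<ᵇ-+ kA j))
                                                      (cong sB (m+n∸m≡n kA j)))) ⟩
    sumBelow sB kB                                          ≡⟨ ΣsB≡n ⟩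
    n                                                       ∎
    where open ≡-Reasoning
  size : ∀ {j} → j < kA + kB → inA j + inB j ≡ L ⊎ inA j + inB j ≡ T
  size {j} _ with j <ᵇ kA
  ... | true  = subst (λ x → x ≡ L ⊎ x ≡ T) (sym (+-identityʳ (sA j))) (sizeA j)
  ... | false = sizeB (j ∸ kA)
  shape : ∀ {j} → j < kA + kB → KDeg≤1 (inA j) (inB j)
  shape {j} _ with j <ᵇ kA
  ... | true  = inj₁ (inj₂ refl)
  ... | false = inj₁ (inj₁ refl)

sumBelow-fits : ∀ {k a : ℕ → ℕ} {L T} q → (∀ {j} → j < q → Fits (k j) L T (a j)) →
  Fits (sumBelow k q) L T (sumBelow a q)
sumBelow-fits {k} {L = L} {T} q fits =
  ≤-trans (≤-reflexive (sym (sumBelow-*ʳ k L q))) (sumBelow-mono-≤ q (λ j<q → proj₁ (fits j<q))) ,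
  ≤-trans (sumBelow-mono-≤ q (λ j<q → proj₂ (fits j<q))) (≤-reflexive (sumBelow-*ʳ k T q))

fits-one : ∀ {L T x} → L ≤ T → x ≡ L ⊎ x ≡ T → Fits 1 L T x
fits-one {L} {T} L≤T (inj₁ refl) = ≤-reflexive (*-identityˡ L) , ≤-trans L≤T (≤-reflexive (sym (*-identityˡ T)))
fits-one {L} {T} L≤T (inj₂ refl) = ≤-trans (≤-reflexive (*-identityˡ L)) L≤T , ≤-reflexive (sym (*-identityˡ T))

-- a class of size at least 3 of an induced subgraph of maximum degree 1 lies inside one part
class-fits : ∀ {L T a b} → 3 ≤ L → L ≤ T → a + b ≡ L ⊎ a + b ≡ T → KDeg≤1 a b →
  Fits (fromBool (0 <ᵇ a)) L T a × Fits (fromBool (not (0 <ᵇ a))) L T b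
class-fits {a = zero}  _   L≤T size _                     = (z≤n , z≤n) , fits-one L≤T size
class-fits {L} {T} {suc a} _ L≤T size (inj₁ (inj₂ refl)) =
  fits-one L≤T (subst (λ x → x ≡ L ⊎ x ≡ T) (+-identityʳ (suc a)) size) , (z≤n , z≤n)
class-fits {L} {a = suc a} {b} L≥3 L≤T size (inj₂ (a≤1 , b≤1)) =
  ⊥-elim (≤⇒≯ (+-mono-≤ a≤1 b≤1) (≤-trans L≥3 L≤a+b))
  where
  L≤a+b : L ≤ suc a + b
  L≤a+b = ≤-trans (≤-reflexive (sym (*-identityˡ L))) (proj₁ (fits-one L≤T size))

profile⇒split : ∀ {m n q L T} → 3 ≤ L → L ≤ T → Profile m n q L T → Split m n q L T
profile⇒split {q = q} {L} {T} L≥3 L≤T P =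
  kA , kB , kA+kB≡q ,
  subst (Fits kA L T) sum-inA (sumBelow-fits q (λ j<q → proj₁ (fits j<q))) ,
  subst (Fits kB L T) sum-inB (sumBelow-fits q (λ j<q → proj₂ (fits j<q)))
  where
  open Profile P
  isA isB : ℕ → ℕ
  isA j = fromBool (0 <ᵇ inA j)
  isB j = fromBool (not (0 <ᵇ inA j))
  kA kB : ℕ
  kA = sumBelow isA q
  kB = sumBelow isB q
  fits : ∀ {j} → j < q → Fits (isA j) L T (inA j) × Fits (isB j) L T (inB j)
  fits j<q = class-fits L≥3 L≤T (size j<q) (shape j<q)
  one : ∀ b → fromBool b + fromBool (not b) ≡ 1
  one true  = refl
  one false = refl
  kA+kB≡q : kA + kB ≡ q
  kA+kB≡q = begin
    kA + kB                               ≡⟨ sym (sumBelow-+ isA isB q) ⟩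
    sumBelow (λ j → isA j + isB j) q      ≡⟨ sumBelow-cong q (λ {j} _ → one (0 <ᵇ inA j)) ⟩
    sumBelow (λ _ → 1) q                  ≡⟨ sumBelow-const 1 q ⟩
    q * 1                                 ≡⟨ *-identityʳ q ⟩
    q                                     ∎
    where open ≡-Reasoning

split-divisible : ∀ {m n q L} → 1 ≤ L → q * L ≡ m + n → L ∣ m → L ∣ n → Split m n q L L
split-divisible {m} {n} {q} {suc L} _ qL≡m+n (divides α m≡αL) (divides β n≡βL) =
  α , β , α+β≡q , exact {m} {α} m≡αL , exact {n} {β} n≡βL
  where
  exact : ∀ {a k} → a ≡ k * suc L → Fits k (suc L) (suc L) a
  exact a≡kL = ≤-reflexive (sym a≡kL) , ≤-reflexive a≡kL
  α+β≡q : α + β ≡ q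
  α+β≡q = *-cancelʳ-≡ (α + β) q (suc L)
    (trans (*-distribʳ-+ (suc L) α β) (trans (sym (cong₂ _+_ m≡αL n≡βL)) (sym qL≡m+n)))

profile-divisible : ∀ {m n q L} → 1 ≤ L → q * L ≡ m + n → L ∣ m ⊎ L ∣ n → Profile m n q L L
profile-divisible {q = q} {L} L≥1 qL≡m+n (inj₁ L∣m) =
  split⇒profile (inj₁ refl) (split-divisible L≥1 qL≡m+n L∣m (∣m+n∣m⇒∣n (subst (L ∣_) qL≡m+n (n∣m*n q)) L∣m))
profile-divisible {m} {n} {q} {L} L≥1 qL≡m+n (inj₂ L∣n) =
  split⇒profile (inj₁ refl) (split-divisible L≥1 qL≡m+n
    (∣m+n∣m⇒∣n (subst (L ∣_) (trans qL≡m+n (+-comm m n)) (n∣m*n q)) L∣n) L∣n)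

profile-+edge : ∀ {m n q L T} → 2 ≡ L ⊎ 2 ≡ T → Profile m n q L T → Profile (suc m) (suc n) (suc q) L T
profile-+edge {L = L} {T} two P = record
  { inA = 1 ∷ₛ inA ; inB = 1 ∷ₛ inB
  ; sum-inA = cong suc sum-inA ; sum-inB = cong suc sum-inB
  ; size = size′ ; shape = shape′ }
  where
  open Profile P
  _∷ₛ_ : ℕ → (ℕ → ℕ) → ℕ → ℕ
  (x ∷ₛ s) zero    = x
  (x ∷ₛ s) (suc j) = s j
  size′ : ∀ {j} → j < suc _ → (1 ∷ₛ inA) j + (1 ∷ₛ inB) j ≡ L ⊎ (1 ∷ₛ inA) j + (1 ∷ₛ inB) j ≡ T
  size′ {zero}  _         = two
  size′ {suc j} (s<s j<q) = size j<q
  shape′ : ∀ {j} → j < suc _ → KDeg≤1 ((1 ∷ₛ inA) j) ((1 ∷ₛ inB) j)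
  shape′ {zero}  _         = inj₂ (≤-refl , ≤-refl)
  shape′ {suc j} (s<s j<q) = shape j<q

odd⇒≡1+⌊/2⌋*2 : ∀ {a} → ¬ 2 ∣ a → a ≡ suc (⌊ a / 2 ⌋ * 2)
odd⇒≡1+⌊/2⌋*2 {a} 2∤a = ≤-antisym
  (s≤s⁻¹ (≤-trans (<1+⌊/⌋* {a} {2} (s≤s z≤n))
    (≤-reflexive (solve 1 (λ h → (con 1 :+ h) :* con 2 := con 1 :+ (con 1 :+ h :* con 2)) refl ⌊ a / 2 ⌋))))
  (≤∧≢⇒< (⌊/⌋*≤ (s≤s z≤n)) (λ ⌊⌋*2≡a → 2∤a (divides ⌊ a / 2 ⌋ (sym ⌊⌋*2≡a))))

profile-exact-2 : ∀ {m n q} → q * 2 ≡ m + n → Profile m n q 2 2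
profile-exact-2 {m} {n} {q} q2≡m+n with 2 ∣? m | 2 ∣? n
... | yes 2∣m | _       = profile-divisible (s≤s z≤n) q2≡m+n (inj₁ 2∣m)
... | no _    | yes 2∣n = profile-divisible (s≤s z≤n) q2≡m+n (inj₂ 2∣n)
... | no 2∤m  | no 2∤n  = both-odd {⌊ m / 2 ⌋} {⌊ n / 2 ⌋} (odd⇒≡1+⌊/2⌋*2 2∤m) (odd⇒≡1+⌊/2⌋*2 2∤n)
  where
  both-odd : ∀ {u w} → m ≡ suc (u * 2) → n ≡ suc (w * 2) → Profile m n q 2 2
  both-odd {u} {w} refl refl =
    subst (λ k → Profile m n k 2 2) (sym q≡1+u+w)
      (profile-+edge (inj₁ refl) (profile-divisible (s≤s z≤n) (*-distribʳ-+ 2 u w) (inj₁ (divides u refl))))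
    where
    q≡1+u+w : q ≡ suc (u + w)
    q≡1+u+w = *-cancelʳ-≡ q (suc (u + w)) 2 (trans q2≡m+n
      (solve 2 (λ u w → (con 1 :+ u :* con 2) :+ (con 1 :+ w :* con 2) := (con 1 :+ (u :+ w)) :* con 2) refl u w))

interval-sum : ∀ {a₁ a₂ b₁ b₂ q} → a₁ ≤ a₂ → b₁ ≤ b₂ → a₁ + b₁ ≤ q → q ≤ a₂ + b₂ →
  Σ ℕ λ kA → Σ ℕ λ kB → kA + kB ≡ q × (a₁ ≤ kA × kA ≤ a₂) × (b₁ ≤ kB × kB ≤ b₂)
interval-sum {a₁} {a₂} {b₁} {b₂} {q} a₁≤a₂ b₁≤b₂ lo hi with q ≤? a₁ + b₂
... | yes q≤a₁+b₂ =
  a₁ , q ∸ a₁ , m+[n∸m]≡n (m+n≤o⇒m≤o a₁ lo) , (≤-refl , a₁≤a₂) ,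
  (m+n≤o⇒m≤o∸n b₁ (subst (_≤ q) (+-comm a₁ b₁) lo) ,
   ≤-trans (∸-monoˡ-≤ a₁ q≤a₁+b₂) (≤-reflexive (m+n∸m≡n a₁ b₂)))
... | no q≰a₁+b₂ =
  q ∸ b₂ , b₂ , m∸n+n≡m (m+n≤o⇒n≤o a₁ a₁+b₂≤q) ,
  (m+n≤o⇒m≤o∸n a₁ a₁+b₂≤q , ≤-trans (∸-monoˡ-≤ b₂ hi) (≤-reflexive (m+n∸n≡m a₂ b₂))) , (b₁≤b₂ , ≤-refl)
  where
  a₁+b₂≤q : a₁ + b₂ ≤ q
  a₁+b₂≤q = <⇒≤ (≰⇒> q≰a₁+b₂)

split-intro : ∀ {m n q L T} → 1 ≤ L → 1 ≤ T → ⌈ m / T ⌉ ≤ ⌊ m / L ⌋ → ⌈ n / T ⌉ ≤ ⌊ n / L ⌋ →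
  ⌈ m / T ⌉ + ⌈ n / T ⌉ ≤ q → q ≤ ⌊ m / L ⌋ + ⌊ n / L ⌋ → Split m n q L T
split-intro {L = L} {T} L≥1 T≥1 intA intB lo hi with interval-sum intA intB lo hi
... | kA , kB , kA+kB≡q , kA∈ , kB∈ = kA , kB , kA+kB≡q , fits kA∈ , fits kB∈
  where
  fits : ∀ {a k} → ⌈ a / T ⌉ ≤ k × k ≤ ⌊ a / L ⌋ → Fits k L T a
  fits (⌈⌉≤k , k≤⌊⌋) = ≤-trans (*-monoˡ-≤ L k≤⌊⌋) (⌊/⌋*≤ L≥1) , ≤-trans (≤⌈/⌉* T≥1) (*-monoˡ-≤ T ⌈⌉≤k)

split-singletons : ∀ {m n q} → m + n ≤ q → Split m n q 0 1
split-singletons {m} {n} {q} m+n≤q =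
  m , q ∸ m , m+[n∸m]≡n (m+n≤o⇒m≤o m m+n≤q) ,
  (≤-trans (≤-reflexive (*-zeroʳ m)) z≤n , ≤-reflexive (sym (*-identityʳ m))) ,
  (≤-trans (≤-reflexive (*-zeroʳ (q ∸ m))) z≤n ,
   ≤-trans (m+n≤o⇒m≤o∸n n (subst (_≤ q) (+-comm m n) m+n≤q)) (≤-reflexive (sym (*-identityʳ (q ∸ m)))))

⌈/⌉+⌈/⌉≤-∣ˡ : ∀ {m n q T} → 1 ≤ T → m + n ≤ q * T → T ∣ m → ⌈ m / T ⌉ + ⌈ n / T ⌉ ≤ q
⌈/⌉+⌈/⌉≤-∣ˡ {m} {n} {q} {T} T≥1 m+n≤qT (divides α m≡αT) =
  ≤-trans (+-monoˡ-≤ ⌈ n / T ⌉ (⌈/⌉-least {m} {T} {α} T≥1 (≤-reflexive m≡αT)))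
          (s≤s⁻¹ (*-cancelʳ-< T (α + ⌈ n / T ⌉) (suc q) (begin-strict
    (α + ⌈ n / T ⌉) * T     ≡⟨ *-distribʳ-+ T α _ ⟩
    α * T + ⌈ n / T ⌉ * T   <⟨ +-monoʳ-< (α * T) (⌈/⌉*< T≥1) ⟩
    α * T + (n + T)         ≡⟨ sym (+-assoc (α * T) n T) ⟩
    α * T + n + T           ≡⟨ cong (λ a → a + n + T) (sym m≡αT) ⟩
    m + n + T               ≤⟨ +-monoˡ-≤ T m+n≤qT ⟩
    q * T + T               ≡⟨ +-comm (q * T) T ⟩
    suc q * T               ∎)))
  where open ≤-Reasoning

⌈/⌉+⌈/⌉≤ : ∀ {m n q T} → 1 ≤ T → m + n ≤ q * T → T ∣ m ⊎ T ∣ n → ⌈ m / T ⌉ + ⌈ n / T ⌉ ≤ q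
⌈/⌉+⌈/⌉≤ T≥1 m+n≤qT (inj₁ T∣m) = ⌈/⌉+⌈/⌉≤-∣ˡ T≥1 m+n≤qT T∣m
⌈/⌉+⌈/⌉≤ {m} {n} {q} {T} T≥1 m+n≤qT (inj₂ T∣n) =
  subst (_≤ q) (+-comm ⌈ n / T ⌉ _) (⌈/⌉+⌈/⌉≤-∣ˡ T≥1 (subst (_≤ q * T) (+-comm m n) m+n≤qT) T∣n)

≤⌊/⌋+⌊/⌋-∣ˡ : ∀ {m n q L} → 1 ≤ L → q * L ≤ m + n → L ∣ m → q ≤ ⌊ m / L ⌋ + ⌊ n / L ⌋
≤⌊/⌋+⌊/⌋-∣ˡ {m} {n} {q} {L} L≥1 qL≤m+n (divides α m≡αL) =
  ≤-trans (s≤s⁻¹ (*-cancelʳ-< L q (suc (α + ⌊ n / L ⌋)) (begin-strict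
    q * L                             ≤⟨ qL≤m+n ⟩
    m + n                             <⟨ +-monoʳ-< m (<1+⌊/⌋* L≥1) ⟩
    m + suc ⌊ n / L ⌋ * L             ≡⟨ cong (_+ suc ⌊ n / L ⌋ * L) m≡αL ⟩
    α * L + suc ⌊ n / L ⌋ * L         ≡⟨ sym (*-distribʳ-+ L α (suc ⌊ n / L ⌋)) ⟩
    (α + suc ⌊ n / L ⌋) * L           ≡⟨ cong (_* L) (+-suc α _) ⟩
    suc (α + ⌊ n / L ⌋) * L           ∎)))
    (+-monoˡ-≤ ⌊ n / L ⌋ (⌊/⌋-greatest {m} {L} {α} L≥1 (≤-reflexive (sym m≡αL))))
  where open ≤-Reasoning

≤⌊/⌋+⌊/⌋ : ∀ {m n q L} → 1 ≤ L → q * L ≤ m + n → L ∣ m ⊎ L ∣ n → q ≤ ⌊ m / L ⌋ + ⌊ n / L ⌋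
≤⌊/⌋+⌊/⌋ L≥1 qL≤m+n (inj₁ L∣m) = ≤⌊/⌋+⌊/⌋-∣ˡ L≥1 qL≤m+n L∣m
≤⌊/⌋+⌊/⌋ {m} {n} {q} {L} L≥1 qL≤m+n (inj₂ L∣n) =
  subst (q ≤_) (+-comm ⌊ n / L ⌋ _) (≤⌊/⌋+⌊/⌋-∣ˡ L≥1 (subst (q * L ≤_) (+-comm m n) qL≤m+n) L∣n)

≤1+⌊/2⌋*2 : ∀ a → a ≤ suc (⌊ a / 2 ⌋ * 2)
≤1+⌊/2⌋*2 a = s≤s⁻¹ (<1+⌊/⌋* {a} {2} (s≤s z≤n))

⌈/2⌉*2≤1+ : ∀ a → ⌈ a / 2 ⌉ * 2 ≤ suc a
⌈/2⌉*2≤1+ a = s≤s⁻¹ (≤-trans (⌈/⌉*< {a} {2} (s≤s z≤n)) (≤-reflexive (+-comm a 2)))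

⌈/2⌉+⌈/2⌉≤ : ∀ {m n q} → m + n < 2 * q → ⌈ m / 2 ⌉ + ⌈ n / 2 ⌉ ≤ q
⌈/2⌉+⌈/2⌉≤ {m} {n} {q} m+n<2q = s≤s⁻¹ (*-cancelʳ-< 2 _ (suc q) (begin-strict
  (⌈ m / 2 ⌉ + ⌈ n / 2 ⌉) * 2       ≡⟨ *-distribʳ-+ 2 ⌈ m / 2 ⌉ _ ⟩
  ⌈ m / 2 ⌉ * 2 + ⌈ n / 2 ⌉ * 2     ≤⟨ +-mono-≤ (⌈/2⌉*2≤1+ m) (⌈/2⌉*2≤1+ n) ⟩
  suc m + suc n                     ≡⟨ cong suc (+-suc m n) ⟩
  suc (suc (m + n))                 <⟨ s≤s (s≤s m+n<2q) ⟩
  suc (suc (2 * q))                 ≡⟨ solve 1 (λ q → con 2 :+ con 2 :* q := (con 1 :+ q) :* con 2) refl q ⟩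
  suc q * 2                         ∎))
  where open ≤-Reasoning

≤⌊/2⌋+⌊/2⌋ : ∀ {m n q} → 2 * q < m + n → q ≤ ⌊ m / 2 ⌋ + ⌊ n / 2 ⌋
≤⌊/2⌋+⌊/2⌋ {m} {n} {q} 2q<m+n = s≤s⁻¹ (*-cancelʳ-< 2 q _ (begin-strict
  q * 2                                   ≡⟨ *-comm q 2 ⟩
  2 * q                                   <⟨ 2q<m+n ⟩
  m + n                                   ≤⟨ +-mono-≤ (≤1+⌊/2⌋*2 m) (≤1+⌊/2⌋*2 n) ⟩
  suc (⌊ m / 2 ⌋ * 2) + suc (⌊ n / 2 ⌋ * 2)
    ≡⟨ solve 2 (λ a b → (con 1 :+ a :* con 2) :+ (con 1 :+ b :* con 2) := (con 1 :+ (a :+ b)) :* con 2)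
               refl ⌊ m / 2 ⌋ ⌊ n / 2 ⌋ ⟩
  suc (⌊ m / 2 ⌋ + ⌊ n / 2 ⌋) * 2         ∎))
  where open ≤-Reasoning

≤⌊/2⌋*3 : ∀ {a} → 2 ≤ a → a ≤ ⌊ a / 2 ⌋ * 3
≤⌊/2⌋*3 {a} a≥2 = begin
  a                         ≤⟨ ≤1+⌊/2⌋*2 a ⟩
  1 + ⌊ a / 2 ⌋ * 2         ≤⟨ +-monoˡ-≤ (⌊ a / 2 ⌋ * 2) (⌊/⌋-greatest {a} {2} {1} (s≤s z≤n) a≥2) ⟩
  ⌊ a / 2 ⌋ + ⌊ a / 2 ⌋ * 2 ≡⟨ sym (*-suc ⌊ a / 2 ⌋ 2) ⟩
  ⌊ a / 2 ⌋ * 3             ∎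
  where open ≤-Reasoning

-- in case (ii) the kA classes of the first part are too small for it, which leaves no room for the second part
sparse⇒¬fits : ∀ {a b d q L T kA kB} → 1 ≤ d → 1 ≤ b → T ≤ suc L → suc d * ⌊ a / d ⌋ < a →
  kA + kB ≡ q → suc q ≡ ⌈ a / d ⌉ + ⌈ b / d ⌉ → kA ≤ ⌊ a / d ⌋ → Fits kA L T a → Fits kB L T b → ⊥
sparse⇒¬fits {a} {b} {d} {q} {L} {T} {kA} {kB}
  d≥1 b≥1 T≤1+L sparse kA+kB≡q 1+q≡⌈⌉+⌈⌉ kA≤⌊⌋ (_ , a≤kAT) (kBL≤b , _) =
  n≮0 (≤-trans b≥1 (subst (b ≤_) (cong (_* d) kB≡0) b≤kBd))
  where
  open ≤-Reasoning
  ⌊⌋<⌈⌉ : ⌊ a / d ⌋ < ⌈ a / d ⌉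
  ⌊⌋<⌈⌉ = *-cancelʳ-< d _ _ (begin-strict
    ⌊ a / d ⌋ * d       ≤⟨ *-monoʳ-≤ ⌊ a / d ⌋ (n≤1+n d) ⟩
    ⌊ a / d ⌋ * suc d   ≡⟨ *-comm ⌊ a / d ⌋ (suc d) ⟩
    suc d * ⌊ a / d ⌋   <⟨ sparse ⟩
    a                   ≤⟨ ≤⌈/⌉* d≥1 ⟩
    ⌈ a / d ⌉ * d       ∎)
  ⌈b⌉≤kB : ⌈ b / d ⌉ ≤ kB
  ⌈b⌉≤kB = +-cancelˡ-≤ (suc kA) ⌈ b / d ⌉ kB (begin
    suc kA + ⌈ b / d ⌉      ≤⟨ +-monoˡ-≤ ⌈ b / d ⌉ (<-≤-trans (s≤s kA≤⌊⌋) ⌊⌋<⌈⌉) ⟩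
    ⌈ a / d ⌉ + ⌈ b / d ⌉   ≡⟨ sym 1+q≡⌈⌉+⌈⌉ ⟩
    suc q                   ≡⟨ cong suc (sym kA+kB≡q) ⟩
    suc kA + kB             ∎)
  b≤kBd : b ≤ kB * d
  b≤kBd = ≤-trans (≤⌈/⌉* d≥1) (*-monoˡ-≤ d ⌈b⌉≤kB)
  1+d<T : suc d < T
  1+d<T = *-cancelˡ-< kA (suc d) T (begin-strict
    kA * suc d          ≤⟨ *-monoˡ-≤ (suc d) kA≤⌊⌋ ⟩
    ⌊ a / d ⌋ * suc d   ≡⟨ *-comm ⌊ a / d ⌋ (suc d) ⟩
    suc d * ⌊ a / d ⌋   <⟨ sparse ⟩
    a                   ≤⟨ a≤kAT ⟩
    kA * T              ∎)
  kB≡0 : kB ≡ 0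
  kB≡0 = n≤0⇒n≡0 (+-cancelʳ-≤ (kB * d) kB 0 (begin
    kB + kB * d         ≡⟨ sym (*-suc kB d) ⟩
    kB * suc d          ≤⟨ *-monoʳ-≤ kB (s≤s⁻¹ (<-≤-trans 1+d<T T≤1+L)) ⟩
    kB * L              ≤⟨ kBL≤b ⟩
    b                   ≤⟨ b≤kBd ⟩
    kB * d              ∎))

CondD⇒¬Split : ∀ {m n d q L T} → 1 ≤ m → 1 ≤ n → 1 ≤ d → T ≤ suc L → CondD m n d →
  suc q ≡ ⌈ m / d ⌉ + ⌈ n / d ⌉ → ¬ Split m n q L T
CondD⇒¬Split {m} {n} {d} {q} {L} {T} m≥1 n≥1 d≥1 T≤1+L cond 1+q≡⌈⌉+⌈⌉
  (kA , kB , kA+kB≡q , fitsA@(kAL≤m , m≤kAT) , fitsB@(kBL≤n , n≤kBT)) = refute cond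
  where
  open ≤-Reasoning
  d<T : d < T
  d<T = ≰⇒> λ T≤d → 1+n≰n (begin
    suc q                   ≡⟨ 1+q≡⌈⌉+⌈⌉ ⟩
    ⌈ m / d ⌉ + ⌈ n / d ⌉   ≤⟨ +-mono-≤ (⌈/⌉-least {m} {d} {kA} d≥1 (≤-trans m≤kAT (*-monoʳ-≤ kA T≤d)))
                                        (⌈/⌉-least {n} {d} {kB} d≥1 (≤-trans n≤kBT (*-monoʳ-≤ kB T≤d))) ⟩
    kA + kB                 ≡⟨ kA+kB≡q ⟩
    q                       ∎)
  d≤L : d ≤ L
  d≤L = s≤s⁻¹ (<-≤-trans d<T T≤1+L)
  kA≤⌊⌋ : kA ≤ ⌊ m / d ⌋
  kA≤⌊⌋ = ⌊/⌋-greatest d≥1 (≤-trans (*-monoʳ-≤ kA d≤L) kAL≤m)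
  kB≤⌊⌋ : kB ≤ ⌊ n / d ⌋
  kB≤⌊⌋ = ⌊/⌋-greatest d≥1 (≤-trans (*-monoʳ-≤ kB d≤L) kBL≤n)
  refute : CondD m n d → ⊥
  refute (inj₁ (d∤m , d∤n)) = 1+n≰n (begin
    suc (suc q)                   ≡⟨ cong (λ k → suc (suc k)) (sym kA+kB≡q) ⟩
    suc (suc (kA + kB))           ≡⟨ cong suc (sym (+-suc kA kB)) ⟩
    suc kA + suc kB               ≤⟨ +-mono-≤ (<-≤-trans (s≤s kA≤⌊⌋) (∤⇒⌊/⌋<⌈/⌉ d≥1 d∤m))
                                              (<-≤-trans (s≤s kB≤⌊⌋) (∤⇒⌊/⌋<⌈/⌉ d≥1 d∤n)) ⟩
    ⌈ m / d ⌉ + ⌈ n / d ⌉         ≡⟨ sym 1+q≡⌈⌉+⌈⌉ ⟩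
    suc q                         ∎)
  refute (inj₂ (inj₁ m-sparse)) = sparse⇒¬fits d≥1 n≥1 T≤1+L m-sparse kA+kB≡q 1+q≡⌈⌉+⌈⌉ kA≤⌊⌋ fitsA fitsB
  refute (inj₂ (inj₂ n-sparse)) =
    sparse⇒¬fits d≥1 m≥1 T≤1+L n-sparse (trans (+-comm kB kA) kA+kB≡q)
                 (trans 1+q≡⌈⌉+⌈⌉ (+-comm ⌈ m / d ⌉ _)) kB≤⌊⌋ fitsB fitsA

CondD? : ∀ a b t → Dec (CondD a b t)
CondD? a b t =
  (¬? (t ∣? a) ×-dec ¬? (t ∣? b)) ⊎-dec ((suc t * ⌊ a / t ⌋ <? a) ⊎-dec (suc t * ⌊ b / t ⌋ <? b))

CondD-large : ∀ {a b t} → 1 ≤ a → a < t → CondD a b t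
CondD-large {a} {t = suc t} a≥1 a<t =
  inj₂ (inj₁ (subst (_< a) (sym (trans (cong (suc (suc t) *_) (m<n⇒m/n≡0 a<t)) (*-zeroʳ (suc (suc t))))) a≥1))

¬CondD-intro : ∀ {a b t} → t ∣ a → a ≤ ⌊ a / t ⌋ * suc t → b ≤ ⌊ b / t ⌋ * suc t → ¬ CondD a b t
¬CondD-intro t∣a _   _   (inj₁ (t∤a , _))  = t∤a t∣a
¬CondD-intro {a} {t = t} _ a≤ _ (inj₂ (inj₁ a-sparse)) = <⇒≱ a-sparse (subst (a ≤_) (*-comm _ (suc t)) a≤)
¬CondD-intro {b = b} {t} _ _ b≤ (inj₂ (inj₂ b-sparse)) = <⇒≱ b-sparse (subst (b ≤_) (*-comm _ (suc t)) b≤)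

¬CondD⇒∣ : ∀ {a b t} → ¬ CondD a b t → t ∣ a ⊎ t ∣ b
¬CondD⇒∣ {a} {b} {t} ¬cond with t ∣? a | t ∣? b
... | yes t∣a | _       = inj₁ t∣a
... | no _    | yes t∣b = inj₂ t∣b
... | no t∤a  | no t∤b  = ⊥-elim (¬cond (inj₁ (t∤a , t∤b)))

¬CondD⇒≤ : ∀ {a b t} → ¬ CondD a b t → a ≤ ⌊ a / t ⌋ * suc t × b ≤ ⌊ b / t ⌋ * suc t
¬CondD⇒≤ {a} {b} {t} ¬cond =
  subst (a ≤_) (*-comm (suc t) _) (≮⇒≥ (λ a-sparse → ¬cond (inj₂ (inj₁ a-sparse)))) ,
  subst (b ≤_) (*-comm (suc t) _) (≮⇒≥ (λ b-sparse → ¬cond (inj₂ (inj₂ b-sparse))))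

≤⌊/⌋*1+ : ∀ {a t} k → 1 ≤ t → k * t ≤ a → a ≤ k * suc t → a ≤ ⌊ a / t ⌋ * suc t
≤⌊/⌋*1+ {t = t} k t≥1 kt≤a a≤k[1+t] = ≤-trans a≤k[1+t] (*-monoˡ-≤ (suc t) (⌊/⌋-greatest {t = k} t≥1 kt≤a))

¬CondD-1 : ∀ a b → ¬ CondD a b 1
¬CondD-1 a b = ¬CondD-intro (1∣ a) (singletons a) (singletons b)
  where
  singletons : ∀ a → a ≤ ⌊ a / 1 ⌋ * 2
  singletons a = ≤⌊/⌋*1+ a (s≤s z≤n) (≤-reflexive (*-identityʳ a)) (m≤m*n a 2)

least-≥ : ∀ {P : ℕ → Set} → (∀ t → Dec (P t)) → ∀ lo k → P (k + lo) →
  Σ ℕ λ d → lo ≤ d × P d × (∀ t → lo ≤ t → t < d → ¬ P t)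
least-≥ P? lo zero    P[lo] = lo , ≤-refl , P[lo] , λ t lo≤t t<lo _ → <⇒≱ t<lo lo≤t
least-≥ {P} P? lo (suc k) P[k+1+lo] with P? lo
... | yes P[lo] = lo , ≤-refl , P[lo] , λ t lo≤t t<lo _ → <⇒≱ t<lo lo≤t
... | no ¬P[lo] with least-≥ P? (suc lo) k (subst P (sym (+-suc k lo)) P[k+1+lo])
...   | d , 1+lo≤d , P[d] , below = d , ≤-trans (n≤1+n lo) 1+lo≤d , P[d] , below′
  where
  below′ : ∀ t → lo ≤ t → t < d → ¬ P t
  below′ t lo≤t t<d with m≤n⇒m<n∨m≡n lo≤t
  ... | inj₁ lo<t  = below t lo<t t<d
  ... | inj₂ refl  = ¬P[lo]

N≡1+3[b+c] : ∀ b c → 3 * b + (3 * c + 1) ≡ 1 + 3 * (b + c)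
N≡1+3[b+c] = solve 2 (λ b c → con 3 :* b :+ (con 3 :* c :+ con 1) := con 1 :+ con 3 :* (b :+ c)) refl

⌈N/[b+c]⌉≡4 : ∀ b c → 1 ≤ b + c → ⌈ (3 * b + (3 * c + 1)) / (b + c) ⌉ ≡ 4
⌈N/[b+c]⌉≡4 b c s≥1 = ≤-antisym (⌈/⌉-least s≥1 N≤4s) (≮⇒≥ λ ⌈⌉<4 →
  <⇒≱ (≤-reflexive (sym (N≡1+3[b+c] b c))) (≤-trans (≤⌈/⌉* s≥1) (*-monoˡ-≤ (b + c) (s≤s⁻¹ ⌈⌉<4))))
  where
  N≤4s : 3 * b + (3 * c + 1) ≤ 4 * (b + c)
  N≤4s = ≤-trans (≤-reflexive (N≡1+3[b+c] b c)) (+-monoˡ-≤ (3 * (b + c)) s≥1)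

+-tightˡ : ∀ {a a′ b b′} → a ≤ a′ → b ≤ b′ → a′ + b′ ≤ a + b → a′ ≡ a
+-tightˡ {a} {a′} {b′ = b′} a≤a′ b≤b′ sum≤ =
  ≤-antisym (+-cancelʳ-≤ b′ a′ a (≤-trans sum≤ (+-monoʳ-≤ a b≤b′))) a≤a′

module Arboricity {b c d : ℕ} (b≥1 : 1 ≤ b) (c≥1 : 1 ≤ c) (d-min : IsMinD (b + c) (3 * b) (3 * c + 1) d) where

  m n N x : ℕ
  m = 3 * b
  n = 3 * c + 1
  N = m + n
  x = ⌈ m / d ⌉ + ⌈ n / d ⌉

  m≥3 : 3 ≤ m
  m≥3 = *-monoʳ-≤ 3 b≥1

  n≥4 : 4 ≤ n
  n≥4 = +-monoˡ-≤ 1 (*-monoʳ-≤ 3 c≥1)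

  ⌈N/[b+c]⌉≡4′ : ⌈ N / (b + c) ⌉ ≡ 4
  ⌈N/[b+c]⌉≡4′ = ⌈N/[b+c]⌉≡4 b c (≤-trans b≥1 (m≤m+n b c))

  d≥4 : 4 ≤ d
  d≥4 = subst (_≤ d) ⌈N/[b+c]⌉≡4′ (proj₁ d-min)

  d≥1 : 1 ≤ d
  d≥1 = ≤-trans (s≤s z≤n) d≥4

  ¬CondD-3 : ¬ CondD m n 3
  ¬CondD-3 = ¬CondD-intro (m∣m*n b)
    (≤⌊/⌋*1+ b (s≤s z≤n) (≤-reflexive (*-comm b 3)) (≤-trans (≤-reflexive (*-comm 3 b)) (*-monoʳ-≤ b (n≤1+n 3))))
    (≤⌊/⌋*1+ c (s≤s z≤n) (≤-trans (≤-reflexive (*-comm c 3)) (m≤m+n (3 * c) 1))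
      (≤-trans (+-monoʳ-≤ (3 * c) c≥1) (≤-reflexive (solve 1 (λ c → con 3 :* c :+ c := c :* con 4) refl c))))

  ¬CondD-<d : ∀ {t} → 1 ≤ t → t ≢ 2 → t < d → ¬ CondD m n t
  ¬CondD-<d {1} _ _ _ = ¬CondD-1 m n
  ¬CondD-<d {2} _ t≢2 _ = ⊥-elim (t≢2 refl)
  ¬CondD-<d {3} _ _ _ = ¬CondD-3
  ¬CondD-<d {t@(suc (suc (suc (suc _))))} _ _ t<d cond =
    <⇒≱ t<d (proj₂ (proj₂ d-min) t (subst (_≤ t) (sym ⌈N/[b+c]⌉≡4′) (s≤s (s≤s (s≤s (s≤s z≤n))))) cond)

  x≥2 : 2 ≤ x
  x≥2 = +-mono-≤ (⌈/⌉-pos (≤-trans (s≤s z≤n) m≥3)) (⌈/⌉-pos (≤-trans (s≤s z≤n) n≥4))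
    where
    ⌈/⌉-pos : ∀ {a} → 1 ≤ a → 1 ≤ ⌈ a / d ⌉
    ⌈/⌉-pos a≥1 = *-cancelʳ-< d 0 _ (<-≤-trans a≥1 (≤⌈/⌉* d≥1))

  x≤b+c : x ≤ b + c
  x≤b+c = +-mono-≤
    (⌈/⌉-least {t = b} d≥1 (≤-trans (≤-reflexive (*-comm 3 b)) (*-monoʳ-≤ b (≤-trans (n≤1+n 3) d≥4))))
    (⌈/⌉-least {t = c} d≥1 (≤-trans (+-monoʳ-≤ (3 * c) c≥1)
      (≤-trans (≤-reflexive (solve 1 (λ c → con 3 :* c :+ c := c :* con 4) refl c)) (*-monoʳ-≤ c d≥4))))

  N≤dq : ∀ {q} → x ≤ q → N ≤ d * q
  N≤dq {q} x≤q = begin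
    m + n                   ≤⟨ +-mono-≤ (≤⌈/⌉* d≥1) (≤⌈/⌉* d≥1) ⟩
    ⌈ m / d ⌉ * d + ⌈ n / d ⌉ * d ≡⟨ sym (*-distribʳ-+ d ⌈ m / d ⌉ _) ⟩
    x * d                   ≤⟨ *-monoˡ-≤ d x≤q ⟩
    q * d                   ≡⟨ *-comm q d ⟩
    d * q                   ∎
    where open ≤-Reasoning

  N≥1 : 1 ≤ N
  N≥1 = ≤-trans (s≤s z≤n) (≤-trans n≥4 (m≤n+m n m))

  nonzero-factor : ∀ {q L} → q * L ≡ N → 1 ≤ L
  nonzero-factor {q} {zero}  qL≡N = ⊥-elim (n≮0 (subst (1 ≤_) (trans (sym qL≡N) (*-zeroʳ q)) N≥1))
  nonzero-factor {L = suc _} _    = s≤s z≤n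

  exact-divisor : ∀ {q L} → x ≤ q → q * L ≡ N → L ≤ d → L ≢ 2 → L ∣ m ⊎ L ∣ n
  exact-divisor {q} x≤q qL≡N L≤d L≢2 with m≤n⇒m<n∨m≡n L≤d
  ... | inj₁ L<d  = ¬CondD⇒∣ (¬CondD-<d (nonzero-factor {q} qL≡N) L≢2 L<d)
  ... | inj₂ refl = inj₁ (divides ⌈ m / d ⌉ (sym (+-tightˡ (≤⌈/⌉* d≥1) (≤⌈/⌉* d≥1) (begin
    ⌈ m / d ⌉ * d + ⌈ n / d ⌉ * d   ≡⟨ sym (*-distribʳ-+ d ⌈ m / d ⌉ _) ⟩
    x * d                           ≤⟨ *-monoˡ-≤ d x≤q ⟩
    q * d                           ≡⟨ qL≡N ⟩
    m + n                           ∎))))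
    where open ≤-Reasoning

  profile-exact : ∀ {q L} → x ≤ q → q * L ≡ N → L ≤ d → Profile m n q L L
  profile-exact {q} {L} x≤q qL≡N L≤d with L ≟ 2
  ... | yes refl = profile-exact-2 qL≡N
  ... | no L≢2   = profile-divisible (nonzero-factor {q} qL≡N) qL≡N (exact-divisor x≤q qL≡N L≤d L≢2)

  m,n≤⌊/L⌋*[1+L] : ∀ {L} → 1 ≤ L → L < d → m ≤ ⌊ m / L ⌋ * suc L × n ≤ ⌊ n / L ⌋ * suc L
  m,n≤⌊/L⌋*[1+L] {L} L≥1 L<d with L ≟ 2
  ... | yes refl = ≤⌊/2⌋*3 (≤-trans (n≤1+n 2) m≥3) , ≤⌊/2⌋*3 (≤-trans (n≤1+n 2) (≤-trans (n≤1+n 3) n≥4))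
  ... | no L≢2   = ¬CondD⇒≤ (¬CondD-<d L≥1 L≢2 L<d)

  q≤⌊m/L⌋+⌊n/L⌋ : ∀ {q L} → 1 ≤ L → L < d → L * q < N → q ≤ ⌊ m / L ⌋ + ⌊ n / L ⌋
  q≤⌊m/L⌋+⌊n/L⌋ {q} {L} L≥1 L<d Lq<N with L ≟ 2
  ... | yes refl = ≤⌊/2⌋+⌊/2⌋ {m} {n} Lq<N
  ... | no L≢2   = ≤⌊/⌋+⌊/⌋ L≥1 (subst (_≤ N) (*-comm L q) (<⇒≤ Lq<N)) (¬CondD⇒∣ (¬CondD-<d L≥1 L≢2 L<d))

  ⌈m/T⌉+⌈n/T⌉≤q : ∀ {q T} → x ≤ q → 1 ≤ T → T ≤ d → N < T * q → ⌈ m / T ⌉ + ⌈ n / T ⌉ ≤ q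
  ⌈m/T⌉+⌈n/T⌉≤q {q} {T} x≤q T≥1 T≤d N<Tq with m≤n⇒m<n∨m≡n T≤d
  ... | inj₂ refl = x≤q
  ... | inj₁ T<d with T ≟ 2
  ...   | yes refl = ⌈/2⌉+⌈/2⌉≤ {m} {n} N<Tq
  ...   | no T≢2   = ⌈/⌉+⌈/⌉≤ T≥1 (subst (N ≤_) (*-comm T q) (<⇒≤ N<Tq)) (¬CondD⇒∣ (¬CondD-<d T≥1 T≢2 T<d))

  split-inexact : ∀ {q L} → x ≤ q → L * q < N → N < suc L * q → suc L ≤ d → Split m n q L (suc L)
  split-inexact {q} {zero}  _   _    N<q   _     = split-singletons (<⇒≤ (subst (N <_) (+-identityʳ q) N<q))
  split-inexact {L = suc L} x≤q Lq<N N<Tq T≤d =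
    split-intro (s≤s z≤n) (s≤s z≤n)
      (⌈/⌉-least {m} (s≤s z≤n) (proj₁ parts)) (⌈/⌉-least {n} (s≤s z≤n) (proj₂ parts))
      (⌈m/T⌉+⌈n/T⌉≤q x≤q (s≤s z≤n) T≤d N<Tq) (q≤⌊m/L⌋+⌊n/L⌋ (s≤s z≤n) T≤d Lq<N)
    where
    parts : m ≤ ⌊ m / suc L ⌋ * suc (suc L) × n ≤ ⌊ n / suc L ⌋ * suc (suc L)
    parts = m,n≤⌊/L⌋*[1+L] (s≤s z≤n) T≤d

  x≤q⇒q≥1 : ∀ {q} → x ≤ q → 1 ≤ q
  x≤q⇒q≥1 x≤q = ≤-trans (s≤s z≤n) (≤-trans x≥2 x≤q)

  ⌈N/q⌉≤d : ∀ {q} → x ≤ q → ⌈ N / q ⌉ ≤ d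
  ⌈N/q⌉≤d x≤q = ⌈/⌉-least (x≤q⇒q≥1 x≤q) (N≤dq x≤q)

  profile-above : ∀ {q} → x ≤ q → EqProfile m n q
  profile-above {q} x≤q with ⌈/⌉≡⌊/⌋⊎1+⌊/⌋ {N} (x≤q⇒q≥1 x≤q)
  ... | inj₁ ⌈⌉≡⌊⌋ =
    subst (Profile m n q ⌊ N / q ⌋) (sym ⌈⌉≡⌊⌋)
      (profile-exact x≤q (⌈/⌉≡⌊/⌋⇒*≡ (x≤q⇒q≥1 x≤q) ⌈⌉≡⌊⌋) (subst (_≤ d) ⌈⌉≡⌊⌋ (⌈N/q⌉≤d x≤q)))
  ... | inj₂ ⌈⌉≡1+⌊⌋ =
    subst (Profile m n q ⌊ N / q ⌋) (sym ⌈⌉≡1+⌊⌋)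
      (split⇒profile (inj₂ refl)
        (split-inexact x≤q ⌊⌋q<N (<1+⌊/⌋* q≥1) (subst (_≤ d) ⌈⌉≡1+⌊⌋ (⌈N/q⌉≤d x≤q))))
    where
    q≥1 : 1 ≤ q
    q≥1 = x≤q⇒q≥1 x≤q
    ⌊⌋q<N : ⌊ N / q ⌋ * q < N
    ⌊⌋q<N = ≤∧≢⇒< (⌊/⌋*≤ q≥1) λ exact →
      1+n≰n (subst (_≤ ⌊ N / q ⌋) ⌈⌉≡1+⌊⌋ (⌈/⌉-least q≥1 (≤-reflexive (sym exact))))

  ¬coloring-below-x : ¬ EqTreeColoring (K m n) (x ∸ 1) 1
  ¬coloring-below-x coloring =
    CondD⇒¬Split (≤-trans (s≤s z≤n) m≥3) (≤-trans (s≤s z≤n) n≥4) d≥1 (⌈/⌉≤1+⌊/⌋ q≥1)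
      (proj₁ (proj₂ d-min)) 1+q≡x (profile⇒split L≥3 (⌊/⌋≤⌈/⌉ q≥1) (coloring⇒profile coloring))
    where
    q : ℕ
    q = x ∸ 1
    1+q≡x : suc q ≡ x
    1+q≡x = m+[n∸m]≡n (≤-trans (s≤s z≤n) x≥2)
    q≥1 : 1 ≤ q
    q≥1 = s≤s⁻¹ (subst (2 ≤_) (sym 1+q≡x) x≥2)
    L≥3 : 3 ≤ ⌊ N / q ⌋
    L≥3 = ⌊/⌋-greatest q≥1 (begin
      3 * q             ≤⟨ *-monoʳ-≤ 3 (≤-trans (n≤1+n q) (subst (_≤ b + c) (sym 1+q≡x) x≤b+c)) ⟩
      3 * (b + c)       ≤⟨ n≤1+n _ ⟩
      1 + 3 * (b + c)   ≡⟨ sym (N≡1+3[b+c] b c) ⟩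
      N                 ∎)
      where open ≤-Reasoning

  arboricity : IsStrongEqVertexArboricity (K m n) 1 x
  arboricity =
    (λ q x≤q → profile⇒coloring (profile-above x≤q)) ,
    (λ p colourable → ≮⇒≥ λ p<x → ¬coloring-below-x (colourable (x ∸ 1) (∸-monoˡ-≤ 1 p<x)))

IsMinD-exists : ∀ {b c} → 1 ≤ b → Σ ℕ (IsMinD (b + c) (3 * b) (3 * c + 1))
IsMinD-exists {b} {c} b≥1
  with least-≥ (CondD? (3 * b) (3 * c + 1)) 4 (3 * b)
         (CondD-large (≤-trans b≥1 (m≤n*m b 3)) (m<m+n (3 * b) z<s))
... | d , 4≤d , cond , below =
  d , subst (_≤ d) (sym ⌈⌉≡4) 4≤d , cond ,
  λ d′ ⌈⌉≤d′ cond′ → ≮⇒≥ λ d′<d → below d′ (subst (_≤ d′) ⌈⌉≡4 ⌈⌉≤d′) d′<d cond′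
  where
  ⌈⌉≡4 : ⌈ (3 * b + (3 * c + 1)) / (b + c) ⌉ ≡ 4
  ⌈⌉≡4 = ⌈N/[b+c]⌉≡4 b c (≤-trans b≥1 (m≤m+n b c))

lemma8 : (b c : ℕ) → 1 ≤ b → 1 ≤ c →
    Σ ℕ λ x → IsP (b + c) (3 * b) (3 * c + 1) x
      × IsStrongEqVertexArboricity (K (3 * b) (3 * c + 1)) 1 x
lemma8 b c b≥1 c≥1 =
  let d , d-min = IsMinD-exists {b} {c} b≥1
  in  _ , (d , d-min , refl) , Arboricity.arboricity b≥1 c≥1 d-min
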